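{- Let $\mathcal{C}$ be a cartesian closed category with an adjunction of endofunctors $\Diamond\dashv\Box$, with unit $\eta^m$ and counit $\varepsilon^m$, and let $r:\mathrm{Id}\Rightarrow\Box$ be a natural transformation preserved by $\Box$, i.e. $\Box(r_A)=r_{\Box A}:\Box A\to\Box\Box A$ for every object $A$. Define $q_A:\Diamond A\to A$ as the adjoint transpose of $r_A$, i.e. $q_A=\varepsilon^m_A\circ\Diamond r_A$. Then for every object $A$, $q_{\Diamond A}=\Diamond(q_A)$ as arrows $\Diamond\Diamond A\to\Diamond A$. -}

module Defs where

open import Level using (Level; _⊔_; suc)
open import Relation.Binary using (Rel; IsEquivalence)

record Category (o ℓ e : Level) : Set (suc (o ⊔ ℓ ⊔ e)) where
  infix  4 _≈_
  infixr 9 _∘_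
  infix  5 _⇒_
  field
    Obj : Set o
    _⇒_ : Obj → Obj → Set ℓ
    _≈_ : ∀ {A B} → Rel (A ⇒ B) e
    id  : ∀ {A} → A ⇒ A
    _∘_ : ∀ {A B C} → B ⇒ C → A ⇒ B → A ⇒ C
    equiv     : ∀ {A B} → IsEquivalence (_≈_ {A} {B})
    assoc     : ∀ {A B C D} {f : A ⇒ B} {g : B ⇒ C} {h : C ⇒ D} →
                (h ∘ g) ∘ f ≈ h ∘ (g ∘ f)
    identityˡ : ∀ {A B} {f : A ⇒ B} → id ∘ f ≈ f
    identityʳ : ∀ {A B} {f : A ⇒ B} → f ∘ id ≈ f
    ∘-resp-≈  : ∀ {A B C} {f h : B ⇒ C} {g i : A ⇒ B} →
                f ≈ h → g ≈ i → f ∘ g ≈ h ∘ i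

module _ {o ℓ e : Level} (C : Category o ℓ e) where
  open Category C

  record Endofunctor : Set (o ⊔ ℓ ⊔ e) where
    field
      F₀ : Obj → Obj
      F₁ : ∀ {A B} → A ⇒ B → F₀ A ⇒ F₀ B
      identity     : ∀ {A} → F₁ (id {A}) ≈ id
      homomorphism : ∀ {X Y Z} {f : X ⇒ Y} {g : Y ⇒ Z} →
                     F₁ (g ∘ f) ≈ F₁ g ∘ F₁ f
      F-resp-≈     : ∀ {A B} {f g : A ⇒ B} → f ≈ g → F₁ f ≈ F₁ g

  IdF : Endofunctor
  IdF = record
    { F₀ = λ A → A ; F₁ = λ f → f
    ; identity = IsEquivalence.refl equiv
    ; homomorphism = IsEquivalence.refl equiv
    ; F-resp-≈ = λ p → p }

  _∘F_ : Endofunctor → Endofunctor → Endofunctor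
  G ∘F F = record
    { F₀ = λ A → G.F₀ (F.F₀ A)
    ; F₁ = λ f → G.F₁ (F.F₁ f)
    ; identity = IsEquivalence.trans equiv (G.F-resp-≈ F.identity) G.identity
    ; homomorphism = IsEquivalence.trans equiv (G.F-resp-≈ F.homomorphism) G.homomorphism
    ; F-resp-≈ = λ p → G.F-resp-≈ (F.F-resp-≈ p) }
    where
      module G = Endofunctor G
      module F = Endofunctor F

  record NatTrans (F G : Endofunctor) : Set (o ⊔ ℓ ⊔ e) where
    private
      module F = Endofunctor F
      module G = Endofunctor G
    field
      η       : ∀ X → F.F₀ X ⇒ G.F₀ X
      commute : ∀ {X Y} (f : X ⇒ Y) → η Y ∘ F.F₁ f ≈ G.F₁ f ∘ η X

  record Adjunction (L R : Endofunctor) : Set (o ⊔ ℓ ⊔ e) where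
    private
      module L = Endofunctor L
      module R = Endofunctor R
    field
      unit   : NatTrans IdF (R ∘F L)
      counit : NatTrans (L ∘F R) IdF
    module unit   = NatTrans unit
    module counit = NatTrans counit
    field
      zig : ∀ {A} → counit.η (L.F₀ A) ∘ L.F₁ (unit.η A) ≈ id
      zag : ∀ {B} → R.F₁ (counit.η B) ∘ unit.η (R.F₀ B) ≈ id

  record CartesianClosed : Set (o ⊔ ℓ ⊔ e) where
    infixr 7 _×_
    infixr 8 _^_
    infixr 8 _⁂_
    field
      ⊤   : Obj
      !   : ∀ {A} → A ⇒ ⊤
      !-unique : ∀ {A} (f : A ⇒ ⊤) → ! ≈ f

      _×_ : Obj → Obj → Obj
      π₁  : ∀ {A B} → A × B ⇒ A
      π₂  : ∀ {A B} → A × B ⇒ B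
      ⟨_,_⟩ : ∀ {X A B} → X ⇒ A → X ⇒ B → X ⇒ A × B
      project₁ : ∀ {X A B} {f : X ⇒ A} {g : X ⇒ B} → π₁ ∘ ⟨ f , g ⟩ ≈ f
      project₂ : ∀ {X A B} {f : X ⇒ A} {g : X ⇒ B} → π₂ ∘ ⟨ f , g ⟩ ≈ g
      ×-unique : ∀ {X A B} {h : X ⇒ A × B} {f : X ⇒ A} {g : X ⇒ B} →
                 π₁ ∘ h ≈ f → π₂ ∘ h ≈ g → ⟨ f , g ⟩ ≈ h

    _⁂_ : ∀ {A B C D} → A ⇒ B → C ⇒ D → A × C ⇒ B × D
    f ⁂ g = ⟨ f ∘ π₁ , g ∘ π₂ ⟩

    field
      _^_  : Obj → Obj → Obj
      eval : ∀ {A B} → (B ^ A) × A ⇒ B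
      curry : ∀ {X A B} → X × A ⇒ B → X ⇒ B ^ A
      β    : ∀ {X A B} {f : X × A ⇒ B} → eval ∘ (curry f ⁂ id) ≈ f
      λ-unique : ∀ {X A B} {f : X × A ⇒ B} {h : X ⇒ B ^ A} →
                 eval ∘ (h ⁂ id) ≈ f → h ≈ curry f

-- Under the adjunction ◇ ⊣ □ an arrow ◇ X ⇒ Y is determined by its transpose
-- X ⇒ □ Y, so it suffices to compare transposes. The transpose of q_{◇A} is
-- r_{◇A}, and that of ◇(q_A) is η_A ∘ q_A by naturality of the unit. Their
-- equality r_{◇A} ≈ η_A ∘ q_A is again checked on transposes, where the
-- hypothesis □ r ≈ r □ and naturality of r turn one side into the other.
module Submission where

open import Defs
open import Level using (Level)
open import Relation.Binary using (Setoid; IsEquivalence)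
import Relation.Binary.Reasoning.Setoid as SetoidReasoning

module HomSetoid {o ℓ e : Level} (C : Category o ℓ e) where
  open Category C

  hom : Obj → Obj → Setoid ℓ e
  hom A B = record { Carrier = A ⇒ B ; _≈_ = _≈_ ; isEquivalence = equiv }

  module ≈ {A B : Obj} = IsEquivalence (equiv {A} {B})

module AdjunctionProperties {o ℓ e : Level} {C : Category o ℓ e}
    {L R : Endofunctor C} (adj : Adjunction C L R) where
  open Category C
  open Adjunction adj
  open HomSetoid C
  private
    module L = Endofunctor L
    module R = Endofunctor R

  Ladjunct : ∀ {X Y} → L.F₀ X ⇒ Y → X ⇒ R.F₀ Y
  Ladjunct {X} g = R.F₁ g ∘ unit.η X

  Radjunct : ∀ {X Y} → X ⇒ R.F₀ Y → L.F₀ X ⇒ Y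
  Radjunct {Y = Y} f = counit.η Y ∘ L.F₁ f

  RLadjunct≈id : ∀ {X Y} (g : L.F₀ X ⇒ Y) → Radjunct (Ladjunct g) ≈ g
  RLadjunct≈id {X} {Y} g = begin
    counit.η Y ∘ L.F₁ (R.F₁ g ∘ unit.η X)              ≈⟨ ∘-resp-≈ ≈.refl L.homomorphism ⟩
    counit.η Y ∘ (L.F₁ (R.F₁ g) ∘ L.F₁ (unit.η X))     ≈⟨ ≈.sym assoc ⟩
    (counit.η Y ∘ L.F₁ (R.F₁ g)) ∘ L.F₁ (unit.η X)     ≈⟨ ∘-resp-≈ (counit.commute g) ≈.refl ⟩
    (g ∘ counit.η (L.F₀ X)) ∘ L.F₁ (unit.η X)          ≈⟨ assoc ⟩
    g ∘ (counit.η (L.F₀ X) ∘ L.F₁ (unit.η X))          ≈⟨ ∘-resp-≈ ≈.refl zig ⟩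
    g ∘ id                                              ≈⟨ identityʳ ⟩
    g                                                   ∎
    where open SetoidReasoning (hom _ _)

  LRadjunct≈id : ∀ {X Y} (f : X ⇒ R.F₀ Y) → Ladjunct (Radjunct f) ≈ f
  LRadjunct≈id {X} {Y} f = begin
    R.F₁ (counit.η Y ∘ L.F₁ f) ∘ unit.η X              ≈⟨ ∘-resp-≈ R.homomorphism ≈.refl ⟩
    (R.F₁ (counit.η Y) ∘ R.F₁ (L.F₁ f)) ∘ unit.η X     ≈⟨ assoc ⟩
    R.F₁ (counit.η Y) ∘ (R.F₁ (L.F₁ f) ∘ unit.η X)     ≈⟨ ∘-resp-≈ ≈.refl (≈.sym (unit.commute f)) ⟩
    R.F₁ (counit.η Y) ∘ (unit.η (R.F₀ Y) ∘ f)          ≈⟨ ≈.sym assoc ⟩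
    (R.F₁ (counit.η Y) ∘ unit.η (R.F₀ Y)) ∘ f          ≈⟨ ∘-resp-≈ zag ≈.refl ⟩
    id ∘ f                                              ≈⟨ identityˡ ⟩
    f                                                   ∎
    where open SetoidReasoning (hom _ _)

  Ladjunct-injective : ∀ {X Y} {g h : L.F₀ X ⇒ Y} → Ladjunct g ≈ Ladjunct h → g ≈ h
  Ladjunct-injective {g = g} {h} p = begin
    g                       ≈⟨ ≈.sym (RLadjunct≈id g) ⟩
    Radjunct (Ladjunct g)   ≈⟨ ∘-resp-≈ ≈.refl (L.F-resp-≈ p) ⟩
    Radjunct (Ladjunct h)   ≈⟨ RLadjunct≈id h ⟩
    h                       ∎
    where open SetoidReasoning (hom _ _)

  Ladjunct-natʳ : ∀ {X Y Z} (h : Y ⇒ Z) (g : L.F₀ X ⇒ Y) →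
                  Ladjunct (h ∘ g) ≈ R.F₁ h ∘ Ladjunct g
  Ladjunct-natʳ {X} h g = begin
    R.F₁ (h ∘ g) ∘ unit.η X           ≈⟨ ∘-resp-≈ R.homomorphism ≈.refl ⟩
    (R.F₁ h ∘ R.F₁ g) ∘ unit.η X      ≈⟨ assoc ⟩
    R.F₁ h ∘ (R.F₁ g ∘ unit.η X)      ∎
    where open SetoidReasoning (hom _ _)

  Ladjunct-L₁ : ∀ {X Y} (f : X ⇒ Y) → Ladjunct (L.F₁ f) ≈ unit.η Y ∘ f
  Ladjunct-L₁ f = ≈.sym (unit.commute f)

module TransposedPoint {o ℓ e : Level} {C : Category o ℓ e}
    {◇ □ : Endofunctor C} (adj : Adjunction C ◇ □) (r : NatTrans C (IdF C) □)
    (□r≈r□ : ∀ A → Category._≈_ C (Endofunctor.F₁ □ (NatTrans.η r A))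
                                   (NatTrans.η r (Endofunctor.F₀ □ A))) where
  open Category C
  open Adjunction adj
  open AdjunctionProperties adj
  open HomSetoid C
  private
    module ◇ = Endofunctor ◇
    module □ = Endofunctor □
    module r = NatTrans r

  q : ∀ A → ◇.F₀ A ⇒ A
  q A = Radjunct (r.η A)

  r-◇≈unit∘q : ∀ A → r.η (◇.F₀ A) ≈ unit.η A ∘ q A
  r-◇≈unit∘q A = Ladjunct-injective (begin
    □.F₁ (r.η (◇.F₀ A)) ∘ unit.η A          ≈⟨ ∘-resp-≈ (□r≈r□ (◇.F₀ A)) ≈.refl ⟩
    r.η (□.F₀ (◇.F₀ A)) ∘ unit.η A          ≈⟨ r.commute (unit.η A) ⟩
    □.F₁ (unit.η A) ∘ r.η A                 ≈⟨ ∘-resp-≈ ≈.refl (≈.sym (LRadjunct≈id (r.η A))) ⟩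
    □.F₁ (unit.η A) ∘ Ladjunct (q A)        ≈⟨ ≈.sym (Ladjunct-natʳ (unit.η A) (q A)) ⟩
    Ladjunct (unit.η A ∘ q A)               ∎)
    where open SetoidReasoning (hom _ _)

  q-◇≈◇q : ∀ A → q (◇.F₀ A) ≈ ◇.F₁ (q A)
  q-◇≈◇q A = Ladjunct-injective (begin
    Ladjunct (q (◇.F₀ A))     ≈⟨ LRadjunct≈id (r.η (◇.F₀ A)) ⟩
    r.η (◇.F₀ A)              ≈⟨ r-◇≈unit∘q A ⟩
    unit.η A ∘ q A            ≈⟨ ≈.sym (Ladjunct-L₁ (q A)) ⟩
    Ladjunct (◇.F₁ (q A))     ∎)
    where open SetoidReasoning (hom _ _)

lemma13 : ∀ {o ℓ e : Level} (C : Category o ℓ e) → CartesianClosed C →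
          (◇ □ : Endofunctor C) (adj : Adjunction C ◇ □) (r : NatTrans C (IdF C) □) →
          (∀ A → Category._≈_ C (Endofunctor.F₁ □ (NatTrans.η r A)) (NatTrans.η r (Endofunctor.F₀ □ A))) →
          let q = λ A → Category._∘_ C (NatTrans.η (Adjunction.counit adj) A) (Endofunctor.F₁ ◇ (NatTrans.η r A))
          in ∀ A → Category._≈_ C (q (Endofunctor.F₀ ◇ A)) (Endofunctor.F₁ ◇ (q A))
lemma13 C _ ◇ □ adj r □r≈r□ = TransposedPoint.q-◇≈◇q adj r □r≈r□
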